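{- Let $\mathbf{K}$ be the class of finite open partial planes, and for $A,B\in\mathbf{K}$ write $A\leq_{HF}B$ if $A$ is a subconfiguration of $B$ and $B$ is HF-constructible from $A$. Then $(\mathbf{K},\leq_{HF})$ is an amalgamation class: for all $A,B,C\in\mathbf{K}$ with $C\leq_{HF}A$ and $C\leq_{HF}B$ there are $D\in\mathbf{K}$ and embeddings $f:A\to D$, $g:B\to D$ with $f\restriction C=g\restriction C$, $f(A)\leq_{HF}D$ and $g(B)\leq_{HF}D$.
   Context: A partial plane is a system of points and lines with incidence such that two distinct points are incident with at most one common line and two distinct lines with at most one common point. A subconfiguration is a subset with induced incidence. A partial plane $P$ is open if there is no finite subconfiguration $X$ of $P$ such that every element of $X$ is incident with at least three elements of $X$. For finite partial planes $A\subseteq B$, $B$ is HF-constructible from $A$ if the elements of $B-A$ can be enumerated $b_1,\dots,b_k$ so that each $b_i$ is incident with at most two elements of $A\cup\{b_1,\dots,b_{i-1}\}$. -}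

module Defs where

open import Data.Nat using (ℕ)
open import Data.Fin using (Fin)
open import Data.Fin.Subset using (Subset; _∈_)
open import Data.Bool using (Bool; T)
open import Data.Unit using (⊤)
open import Data.Empty using (⊥)
open import Data.Product using (Σ; ∃; _×_; ∃-syntax)
open import Data.Sum using (_⊎_)
open import Data.List using (List; []; _∷_)
open import Data.List.Relation.Unary.Unique.Propositional using (Unique)
import Data.List.Membership.Propositional as LM
open import Relation.Nullary using (¬_)
open import Relation.Binary.PropositionalEquality using (_≡_; _≢_)
open import Function.Definitions using (Injective)

record PartialPlane : Set where
  field
    size    : ℕ
    isPoint : Fin size → Bool
    I       : Fin size → Fin size → Bool
    I-sym   : ∀ x y → I x y ≡ I y x
    I-type  : ∀ x y → T (I x y) → isPoint x ≢ isPoint y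
    linear  : ∀ x y u v → x ≢ y → u ≢ v →
              T (I x u) → T (I y u) → T (I x v) → T (I y v) → ⊥

open PartialPlane public

AtLeastThree : ∀ {n} → (Fin n → Set) → Set
AtLeastThree P = ∃[ x ] ∃[ y ] ∃[ z ]
  (x ≢ y × x ≢ z × y ≢ z × P x × P y × P z)

AtMostTwo : ∀ {n} → (Fin n → Set) → Set
AtMostTwo P = ¬ AtLeastThree P

Open : PartialPlane → Set
Open P = ∀ (X : Subset (size P)) → (∃[ x ] (x ∈ X)) →
  ¬ (∀ x → x ∈ X → AtLeastThree (λ y → y ∈ X × T (I P x y)))

record Embedding (A B : PartialPlane) : Set where
  field
    map       : Fin (size A) → Fin (size B)
    injective : Injective _≡_ _≡_ map
    pres-type : ∀ x → isPoint B (map x) ≡ isPoint A x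
    pres-I    : ∀ x y → I B (map x) (map y) ≡ I A x y

open Embedding public

HFSteps : (P : PartialPlane) → (Fin (size P) → Set) → List (Fin (size P)) → Set
HFSteps P S []       = ⊤
HFSteps P S (b ∷ bs) =
  AtMostTwo (λ x → T (I P b x) × S x) × HFSteps P (λ x → S x ⊎ x ≡ b) bs

HFConstructible : (P : PartialPlane) → (Fin (size P) → Set) → Set
HFConstructible P S = ∃[ bs ]
  (Unique bs × (∀ d → (LM._∈_ d bs → ¬ S d) × (¬ S d → LM._∈_ d bs))
   × HFSteps P S bs)

-- f(A) ≤_HF B for an embedding f : A → B (the image is automatically an
-- induced subconfiguration).
HFEmbedding : {A B : PartialPlane} → Embedding A B → Set
HFEmbedding {A} {B} f = HFConstructible B (λ d → ∃[ a ] (map f a ≡ d))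

-- Enumerate B over C as b₁,…,b_k, each incident with at most two earlier elements, and copy
-- the bᵢ one by one into a plane D that starts as A and stays HF-constructible both over A
-- and over the part of B copied so far.  If two neighbours of bᵢ have copies with a common
-- neighbour w in D, then w lies outside the copy (B is linear), so it appears in the HF
-- enumeration of D over the copy with exactly those two neighbours there; sending bᵢ to w
-- is then an embedding and w can be moved into the base of the enumeration.  Otherwise a
-- new element incident exactly with the copies of the neighbours of bᵢ is adjoined; an
-- element with at most two neighbours cannot lie in a closed subconfiguration, so D stays
-- open.
module Submission where

open import Defs
open import Data.Bool using (Bool; true; false; T; not)
open import Data.Bool.Properties using (¬-not)
open import Data.Empty using (⊥; ⊥-elim)
open import Data.Nat using (ℕ)
import Data.Nat as ℕ
open import Data.Fin using (Fin; zero; suc; _≟_)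
open import Data.Fin.Properties using (suc-injective; any?)
import Data.Fin.Subset as Subset
open import Data.List using (List; []; _∷_; _++_)
import Data.List as List
open import Data.List.Membership.Propositional using (_∈_)
open import Data.List.Membership.Propositional.Properties using (∈-map⁺; ∈-map⁻; ∈-++⁺ˡ; ∈-++⁺ʳ; ∈-++⁻)
open import Data.List.Relation.Unary.All as All using ([]; _∷_)
open import Data.List.Relation.Unary.Any using (here; there)
open import Data.List.Relation.Unary.Unique.Propositional using (Unique; []; _∷_)
open import Data.List.Relation.Unary.Unique.Propositional.Properties as Unique using ()
open import Data.Product using (Σ; ∃; _×_; ∃-syntax; _,_; proj₁; proj₂; swap)
open import Data.Sum using (_⊎_; inj₁; inj₂; [_,_])
open import Data.Unit using (tt)
open import Data.Vec using (_∷_; here; there)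
open import Function using (_∘_; _⇔_; mk⇔)
open import Relation.Nullary using (¬_; Dec; yes; no; isYes; ¬?)
open import Relation.Nullary.Decidable using (T?; _×-dec_; _⊎-dec_; does-⇔; toWitness; fromWitness)
open import Relation.Binary.PropositionalEquality using (_≡_; _≢_; refl; sym; trans; cong; subst)
open import Relation.Unary using (_⊆_; _≐_)

_∪｛_｝ : ∀ {n} → (Fin n → Set) → Fin n → Fin n → Set
(S ∪｛ b ｝) x = S x ⊎ x ≡ b

T-⇔⇒≡ : ∀ {x y} → (T x ⇔ T y) → x ≡ y
T-⇔⇒≡ {x} {y} equiv = does-⇔ equiv (T? x) (T? y)

module _ (P : PartialPlane) where

  I-irrefl : ∀ x → I P x x ≡ false
  I-irrefl x with I P x x in eq
  ... | true  = ⊥-elim (I-type P x x (subst T (sym eq) tt) refl)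
  ... | false = refl

  T-I-sym : ∀ {x y} → T (I P x y) → T (I P y x)
  T-I-sym {x} {y} = subst T (I-sym P x y)

module _ {n : ℕ} where

  AtMostTwo-mono : ∀ {Q R : Fin n → Set} → Q ⊆ R → AtMostTwo R → AtMostTwo Q
  AtMostTwo-mono Q⊆R bound (x , y , z , x≢y , x≢z , y≢z , qx , qy , qz) =
    bound (x , y , z , x≢y , x≢z , y≢z , Q⊆R qx , Q⊆R qy , Q⊆R qz)

  AtMostTwo-third : ∀ {Q : Fin n → Set} → AtMostTwo Q → ∀ {x y z} →
    x ≢ y → Q x → Q y → Q z → z ≡ x ⊎ z ≡ y
  AtMostTwo-third bound {x} {y} {z} x≢y qx qy qz with z ≟ x | z ≟ y
  ... | yes z≡x | _       = inj₁ z≡x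
  ... | no _    | yes z≡y = inj₂ z≡y
  ... | no z≢x  | no z≢y  =
    ⊥-elim (bound (x , y , z , x≢y , z≢x ∘ sym , z≢y ∘ sym , qx , qy , qz))

module _ (P : PartialPlane) where

  HFSteps-⊆ : ∀ {S S' : Fin (size P) → Set} bs → S' ⊆ S → HFSteps P S bs → HFSteps P S' bs
  HFSteps-⊆ []       S'⊆S _               = tt
  HFSteps-⊆ (b ∷ bs) S'⊆S (bound , steps) =
    AtMostTwo-mono (λ (i , s) → i , S'⊆S s) bound ,
    HFSteps-⊆ bs (λ { (inj₁ s) → inj₁ (S'⊆S s) ; (inj₂ e) → inj₂ e }) steps

  HFConstructible-≐ : ∀ {S S' : Fin (size P) → Set} → S ≐ S' →
    HFConstructible P S → HFConstructible P S'
  HFConstructible-≐ (S⊆S' , S'⊆S) (bs , unique , partition , steps) =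
    bs , unique ,
    (λ d → (λ d∈bs s' → proj₁ (partition d) d∈bs (S'⊆S s')) ,
           (λ ¬s' → proj₂ (partition d) (¬s' ∘ S⊆S'))) ,
    HFSteps-⊆ bs S'⊆S steps

  HFSteps-bound : ∀ {S : Fin (size P) → Set} bs {w} → HFSteps P S bs → w ∈ bs →
    AtMostTwo (λ z → T (I P w z) × S z)
  HFSteps-bound (b ∷ bs) (bound , _)     (here refl) = bound
  HFSteps-bound (b ∷ bs) (_     , steps) (there w∈bs) =
    AtMostTwo-mono (λ (i , s) → i , inj₁ s) (HFSteps-bound bs steps w∈bs)

  HFSteps-++ : ∀ {S : Fin (size P) → Set} xs {ys} → HFSteps P S xs →
    HFSteps P (λ z → S z ⊎ z ∈ xs) ys → HFSteps P S (xs ++ ys)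
  HFSteps-++ []       {ys} _               steps' = HFSteps-⊆ ys inj₁ steps'
  HFSteps-++ {S} (x ∷ xs) {ys} (bound , steps) steps' =
    bound , HFSteps-++ xs steps (HFSteps-⊆ ys shift steps')
    where
    shift : ∀ {z} → (S ∪｛ x ｝) z ⊎ z ∈ xs → S z ⊎ z ∈ x ∷ xs
    shift (inj₁ (inj₁ s))   = inj₁ s
    shift (inj₁ (inj₂ z≡x)) = inj₂ (here z≡x)
    shift (inj₂ z∈xs)       = inj₂ (there z∈xs)

  -- A listed element w with two S-neighbours can be moved into the base: no element listed
  -- before w is incident with w, since it would be a third neighbour of w at w's step.
  HFSteps-absorb : ∀ {S : Fin (size P) → Set} bs {w a a'} → Unique bs →
    (∀ {q} → q ∈ bs → ¬ S q) → HFSteps P S bs → w ∈ bs →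
    a ≢ a' → T (I P w a) × S a → T (I P w a') × S a' →
    ∃[ bs' ] (Unique bs' × (∀ {q} → q ∈ bs' → q ∈ bs × q ≢ w) ×
              (∀ {q} → q ∈ bs → q ≢ w → q ∈ bs') × HFSteps P (S ∪｛ w ｝) bs')
  HFSteps-absorb (b ∷ bs) (b∉bs ∷ unique) _ (_ , steps) (here refl) _ _ _ =
    bs , unique , (λ q∈bs → there q∈bs , All.lookup b∉bs q∈bs ∘ sym) ,
    (λ { (here refl) q≢w → ⊥-elim (q≢w refl) ; (there q∈bs) _ → q∈bs }) , steps
  HFSteps-absorb {S} (b ∷ bs) {w} {a} {a'} (b∉bs ∷ unique) ∉S (bound , steps) (there w∈bs) a≢a' wa wa'
    with HFSteps-absorb bs unique ∉S' steps w∈bs a≢a' (proj₁ wa , inj₁ (proj₂ wa)) (proj₁ wa' , inj₁ (proj₂ wa'))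
    where
    ∉S' : ∀ {q} → q ∈ bs → ¬ (S ∪｛ b ｝) q
    ∉S' q∈bs (inj₁ s)    = ∉S (there q∈bs) s
    ∉S' q∈bs (inj₂ refl) = All.lookup b∉bs q∈bs refl
  ... | bs' , unique' , sound , complete , steps' =
    b ∷ bs' ,
    All.tabulate (λ q∈bs' → All.lookup b∉bs (proj₁ (sound q∈bs'))) ∷ unique' ,
    (λ { (here refl) → here refl , b≢w ; (there q∈bs') → there (proj₁ (sound q∈bs')) , proj₂ (sound q∈bs') }) ,
    (λ { (here refl) _ → here refl ; (there q∈bs) q≢w → there (complete q∈bs q≢w) }) ,
    AtMostTwo-mono (λ { (i , inj₁ s) → i , s ; (i , inj₂ refl) → ⊥-elim (b≁w i) }) bound ,
    HFSteps-⊆ bs' reorder steps'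
    where
    b≢w : b ≢ w
    b≢w = All.lookup b∉bs w∈bs
    b∉S : ∀ {x} → S x → b ≢ x
    b∉S s refl = ∉S (here refl) s
    b≁w : ¬ T (I P b w)
    b≁w i = HFSteps-bound bs steps w∈bs
      (a , a' , b , a≢a' , b∉S (proj₂ wa) ∘ sym , b∉S (proj₂ wa') ∘ sym ,
       (proj₁ wa , inj₁ (proj₂ wa)) , (proj₁ wa' , inj₁ (proj₂ wa')) , (T-I-sym P i , inj₂ refl))
    reorder : ∀ {z} → ((S ∪｛ w ｝) ∪｛ b ｝) z → ((S ∪｛ b ｝) ∪｛ w ｝) z
    reorder (inj₁ (inj₁ s)) = inj₁ (inj₁ s)
    reorder (inj₁ (inj₂ e)) = inj₂ e
    reorder (inj₂ e)        = inj₁ (inj₂ e)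

  HFConstructible-absorb : ∀ {S : Fin (size P) → Set} {w a a'} → HFConstructible P S →
    ¬ S w → a ≢ a' → T (I P w a) × S a → T (I P w a') × S a' → HFConstructible P (S ∪｛ w ｝)
  HFConstructible-absorb (bs , unique , partition , steps) ¬Sw a≢a' wa wa'
    with HFSteps-absorb bs unique (proj₁ (partition _)) steps (proj₂ (partition _) ¬Sw) a≢a' wa wa'
  ... | bs' , unique' , sound , complete , steps' =
    bs' , unique' ,
    (λ d → (λ d∈bs' → λ { (inj₁ s)    → proj₁ (partition d) (proj₁ (sound d∈bs')) s
                        ; (inj₂ refl) → proj₂ (sound d∈bs') refl }) ,
           (λ ¬s → complete (proj₂ (partition d) (¬s ∘ inj₁)) (¬s ∘ inj₂))) ,
    steps'

idₑ : ∀ {P} → Embedding P P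
idₑ = record { map = λ x → x ; injective = λ e → e ; pres-type = λ _ → refl ; pres-I = λ _ _ → refl }

_∘ₑ_ : ∀ {A P Q} → Embedding P Q → Embedding A P → Embedding A Q
g ∘ₑ f = record
  { map       = map g ∘ map f
  ; injective = injective f ∘ injective g
  ; pres-type = λ x → trans (pres-type g (map f x)) (pres-type f x)
  ; pres-I    = λ x y → trans (pres-I g (map f x) (map f y)) (pres-I f x y)
  }

idₑ-HF : ∀ {P} → HFEmbedding (idₑ {P})
idₑ-HF = [] , [] , (λ d → (λ ()) , (λ ¬img → ⊥-elim (¬img (d , refl)))) , tt

module _ {P Q : PartialPlane} (g : Embedding P Q) where

  HFSteps-map : ∀ {S : Fin (size P) → Set} {S' : Fin (size Q) → Set} bs →
    (∀ {p y} → p ∈ bs → S' y → T (I Q (map g p) y) → ∃[ x ] (map g x ≡ y × S x)) →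
    HFSteps P S bs → HFSteps Q S' (List.map (map g) bs)
  HFSteps-map []       _    _               = tt
  HFSteps-map {S} {S'} (p ∷ bs) pull (bound , steps) = bound' , HFSteps-map bs pull' steps
    where
    back : ∀ {y} → T (I Q (map g p) y) × S' y → ∃[ x ] (map g x ≡ y × T (I P p x) × S x)
    back (i , s) with pull (here refl) s i
    ... | x , refl , sx = x , refl , subst T (pres-I g p x) i , sx
    apart : ∀ {x x'} → map g x ≢ map g x' → x ≢ x'
    apart gx≢gx' x≡x' = gx≢gx' (cong (map g) x≡x')
    bound' : AtMostTwo (λ y → T (I Q (map g p) y) × S' y)
    bound' (_ , _ , _ , y₁≢y₂ , y₁≢y₃ , y₂≢y₃ , q₁ , q₂ , q₃)
      with back q₁ | back q₂ | back q₃
    ... | x₁ , refl , r₁ | x₂ , refl , r₂ | x₃ , refl , r₃ =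
      bound (x₁ , x₂ , x₃ , apart y₁≢y₂ , apart y₁≢y₃ , apart y₂≢y₃ , r₁ , r₂ , r₃)
    pull' : ∀ {p' y} → p' ∈ bs → (S' ∪｛ map g p ｝) y → T (I Q (map g p') y) →
      ∃[ x ] (map g x ≡ y × (S ∪｛ p ｝) x)
    pull' p'∈bs (inj₁ s) i with pull (there p'∈bs) s i
    ... | x , gx≡y , sx = x , gx≡y , inj₁ sx
    pull' p'∈bs (inj₂ refl) i = p , refl , inj₂ refl

HFEmbedding-∘ : ∀ {A P Q} (f : Embedding A P) (g : Embedding P Q) →
  HFEmbedding f → HFEmbedding g → HFEmbedding (g ∘ₑ f)
HFEmbedding-∘ {P = P} {Q} f g (bsf , uniquef , partitionf , stepsf) (bsg , uniqueg , partitiong , stepsg) =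
  List.map (map g) bsf ++ bsg ,
  Unique.++⁺ (Unique.map⁺ (injective g) uniquef) uniqueg disjoint ,
  (λ d → sound d , complete d) ,
  HFSteps-++ Q (List.map (map g) bsf)
    (HFSteps-map g bsf (λ { _ (a , refl) _ → map f a , refl , a , refl }) stepsf)
    (HFSteps-⊆ Q bsg inImage stepsg)
  where
  disjoint : ∀ {y} → ¬ (y ∈ List.map (map g) bsf × y ∈ bsg)
  disjoint (y∈gbsf , y∈bsg) with ∈-map⁻ (map g) y∈gbsf
  ... | x , _ , refl = proj₁ (partitiong _) y∈bsg (x , refl)
  inImage : ∀ {y} → (∃[ a ] map g (map f a) ≡ y) ⊎ y ∈ List.map (map g) bsf → ∃[ x ] map g x ≡ y
  inImage (inj₁ (a , e)) = map f a , e
  inImage (inj₂ y∈gbsf) with ∈-map⁻ (map g) y∈gbsf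
  ... | x , _ , e = x , sym e
  sound : ∀ d → d ∈ List.map (map g) bsf ++ bsg → ¬ (∃[ a ] map g (map f a) ≡ d)
  sound d d∈ (a , refl) with ∈-++⁻ (List.map (map g) bsf) d∈
  ... | inj₁ d∈gbsf with ∈-map⁻ (map g) d∈gbsf
  ...   | x , x∈bsf , e = proj₁ (partitionf x) x∈bsf (a , injective g e)
  sound d d∈ (a , refl) | inj₂ d∈bsg = proj₁ (partitiong d) d∈bsg (map f a , refl)
  complete : ∀ d → ¬ (∃[ a ] map g (map f a) ≡ d) → d ∈ List.map (map g) bsf ++ bsg
  complete d ¬img with any? (λ x → map g x ≟ d)
  ... | yes (x , refl) = ∈-++⁺ˡ (∈-map⁺ (map g)
                           (proj₂ (partitionf x) λ { (a , refl) → ¬img (a , refl) }))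
  ... | no ¬gx = ∈-++⁺ʳ (List.map (map g) bsf) (proj₂ (partitiong d) ¬gx)

-- P with a new element zero of type t incident exactly with N; old elements become suc x.
module Adjoin (P : PartialPlane) (t : Bool) (N : Fin (size P) → Bool)
  (N-type  : ∀ {y} → T (N y) → t ≢ isPoint P y)
  (N-apart : ∀ {u v z} → u ≢ v → T (N u) → T (N v) → T (I P u z) → T (I P v z) → ⊥)
  (N-bound : AtMostTwo (T ∘ N)) where

  isPoint⁺ : Fin (ℕ.suc (size P)) → Bool
  isPoint⁺ zero    = t
  isPoint⁺ (suc x) = isPoint P x

  I⁺ : Fin (ℕ.suc (size P)) → Fin (ℕ.suc (size P)) → Bool
  I⁺ zero    zero    = false
  I⁺ zero    (suc y) = N y
  I⁺ (suc x) zero    = N x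
  I⁺ (suc x) (suc y) = I P x y

  I⁺-sym : ∀ x y → I⁺ x y ≡ I⁺ y x
  I⁺-sym zero    zero    = refl
  I⁺-sym zero    (suc y) = refl
  I⁺-sym (suc x) zero    = refl
  I⁺-sym (suc x) (suc y) = I-sym P x y

  I⁺-type : ∀ x y → T (I⁺ x y) → isPoint⁺ x ≢ isPoint⁺ y
  I⁺-type zero    (suc y) i   = N-type i
  I⁺-type (suc x) zero    i e = N-type i (sym e)
  I⁺-type (suc x) (suc y) i   = I-type P x y i

  suc-≢ : ∀ {n} {x y : Fin n} → suc x ≢ suc y → x ≢ y
  suc-≢ sx≢sy x≡y = sx≢sy (cong suc x≡y)

  I⁺-linear : ∀ x y u v → x ≢ y → u ≢ v →
    T (I⁺ x u) → T (I⁺ y u) → T (I⁺ x v) → T (I⁺ y v) → ⊥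
  I⁺-linear zero    zero    _       _       x≢y _   _ _ _ _ = x≢y refl
  I⁺-linear zero    (suc y) (suc u) (suc v) _   u≢v a b c d =
    N-apart (suc-≢ u≢v) a c (T-I-sym P b) (T-I-sym P d)
  I⁺-linear (suc x) zero    (suc u) (suc v) _   u≢v a b c d =
    N-apart (suc-≢ u≢v) b d (T-I-sym P a) (T-I-sym P c)
  I⁺-linear (suc x) (suc y) zero    zero    _   u≢v _ _ _ _ = u≢v refl
  I⁺-linear (suc x) (suc y) zero    (suc v) x≢y _   a b c d = N-apart (suc-≢ x≢y) a b c d
  I⁺-linear (suc x) (suc y) (suc u) zero    x≢y _   a b c d = N-apart (suc-≢ x≢y) c d a b
  I⁺-linear (suc x) (suc y) (suc u) (suc v) x≢y u≢v a b c d =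
    linear P x y u v (suc-≢ x≢y) (suc-≢ u≢v) a b c d

  plane : PartialPlane
  plane = record
    { size = ℕ.suc (size P) ; isPoint = isPoint⁺ ; I = I⁺
    ; I-sym = I⁺-sym ; I-type = I⁺-type ; linear = I⁺-linear }

  raise : Embedding P plane
  raise = record { map = suc ; injective = suc-injective ; pres-type = λ _ → refl ; pres-I = λ _ _ → refl }

  new-bound : AtMostTwo (λ y → T (I⁺ zero y))
  new-bound (suc x , suc y , suc z , x≢y , x≢z , y≢z , nx , ny , nz) =
    N-bound (x , y , z , suc-≢ x≢y , suc-≢ x≢z , suc-≢ y≢z , nx , ny , nz)

  raise-HF : HFEmbedding raise
  raise-HF = zero ∷ [] , [] ∷ [] ,
    (λ d → (λ { (here refl) (_ , ()) }) , zero-only d) ,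
    AtMostTwo-mono proj₁ new-bound , tt
    where
    zero-only : ∀ d → ¬ (∃[ x ] suc x ≡ d) → d ∈ zero ∷ []
    zero-only zero    _     = here refl
    zero-only (suc x) ¬img = ⊥-elim (¬img (x , refl))

  plane-open : Open P → Open plane
  plane-open P-open (true ∷ X) _ rich with rich zero here
  ... | x , y , z , x≢y , x≢z , y≢z , (_ , nx) , (_ , ny) , (_ , nz) =
    new-bound (x , y , z , x≢y , x≢z , y≢z , nx , ny , nz)
  plane-open P-open (false ∷ X) (suc x , there x∈X) rich = P-open X (x , x∈X) rich'
    where
    rich' : ∀ x → x Subset.∈ X → AtLeastThree (λ y → y Subset.∈ X × T (I P x y))
    rich' x x∈X with rich (suc x) (there x∈X)
    ... | suc a , suc b , suc c , a≢b , a≢c , b≢c , (there a∈X , ia) , (there b∈X , ib) , (there c∈X , ic) =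
      a , b , c , suc-≢ a≢b , suc-≢ a≢c , suc-≢ b≢c , (a∈X , ia) , (b∈X , ib) , (c∈X , ic)

record PartialEmbedding (B P : PartialPlane) : Set₁ where
  field
    _↦_          : Fin (size B) → Fin (size P) → Set
    _↦?_         : ∀ d z → Dec (d ↦ z)
    ↦-functional : ∀ {d z z'} → d ↦ z → d ↦ z' → z ≡ z'
    ↦-injective  : ∀ {d d' z} → d ↦ z → d' ↦ z → d ≡ d'
    ↦-type       : ∀ {d z} → d ↦ z → isPoint P z ≡ isPoint B d
    ↦-I          : ∀ {d d' z z'} → d ↦ z → d' ↦ z' → I P z z' ≡ I B d d'

  dom : Fin (size B) → Set
  dom d = ∃[ z ] d ↦ z

  img : Fin (size P) → Set
  img z = ∃[ d ] d ↦ z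

open PartialEmbedding using (dom; img)

inverse : ∀ {C B} → Embedding C B → PartialEmbedding B C
inverse e = record
  { _↦_          = λ d c → map e c ≡ d
  ; _↦?_         = λ d c → map e c ≟ d
  ; ↦-functional = λ e₁ e₂ → injective e (trans e₁ (sym e₂))
  ; ↦-injective  = λ e₁ e₂ → trans (sym e₁) e₂
  ; ↦-type       = λ { {z = c} refl → sym (pres-type e c) }
  ; ↦-I          = λ { {z = c} {c'} refl refl → sym (pres-I e c c') }
  }

_∘ₚ_ : ∀ {B P Q} → Embedding P Q → PartialEmbedding B P → PartialEmbedding B Q
_∘ₚ_ {B} {P} {Q} g h = record
  { _↦_          = λ d y → ∃[ z ] (d ↦ z × map g z ≡ y)
  ; _↦?_         = λ d y → any? (λ z → (d ↦? z) ×-dec (map g z ≟ y))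
  ; ↦-functional = λ { (z , r , refl) (z' , r' , refl) → cong (map g) (↦-functional r r') }
  ; ↦-injective  = λ { (z , r , refl) (z' , r' , e) → ↦-injective r (subst (_ ↦_) (injective g e) r') }
  ; ↦-type       = λ { (z , r , refl) → trans (pres-type g z) (↦-type r) }
  ; ↦-I          = λ { (z , r , refl) (z' , r' , refl) → trans (pres-I g z z') (↦-I r r') }
  }
  where open PartialEmbedding h

dom-∘ₚ : ∀ {B P Q} (g : Embedding P Q) (h : PartialEmbedding B P) → dom (g ∘ₚ h) ≐ dom h
dom-∘ₚ g h = (λ (_ , z , r , _) → z , r) , (λ (z , r) → map g z , z , r , refl)

toEmbedding : ∀ {B P} (h : PartialEmbedding B P) → (∀ d → dom h d) → Embedding B P
toEmbedding {B} {P} h total = record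
  { map       = λ d → proj₁ (total d)
  ; injective = λ {d} {d'} e → ↦-injective (proj₂ (total d)) (subst (d' ↦_) (sym e) (proj₂ (total d')))
  ; pres-type = λ d → ↦-type (proj₂ (total d))
  ; pres-I    = λ d d' → ↦-I (proj₂ (total d)) (proj₂ (total d'))
  }
  where open PartialEmbedding h

img-toEmbedding : ∀ {B P} (h : PartialEmbedding B P) (total : ∀ d → dom h d) →
  img h ≐ (λ z → ∃[ d ] map (toEmbedding h total) d ≡ z)
img-toEmbedding h total =
  (λ (d , r) → d , ↦-functional (proj₂ (total d)) r) ,
  (λ { (d , refl) → d , proj₂ (total d) })
  where open PartialEmbedding h

module _ {B P : PartialPlane} (h : PartialEmbedding B P) where
  open PartialEmbedding h hiding (dom; img)

  module _ {b w} (b∉dom : ¬ dom h b) (w∉img : ¬ img h w) (type : isPoint P w ≡ isPoint B b)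
           (incidence : ∀ {d z} → d ↦ z → I P w z ≡ I B b d) where

    extend : PartialEmbedding B P
    extend = record
      { _↦_          = λ d z → d ↦ z ⊎ (d ≡ b × z ≡ w)
      ; _↦?_         = λ d z → (d ↦? z) ⊎-dec ((d ≟ b) ×-dec (z ≟ w))
      ; ↦-functional = functional
      ; ↦-injective  = injective′
      ; ↦-type       = λ { (inj₁ r) → ↦-type r ; (inj₂ (refl , refl)) → type }
      ; ↦-I          = incidence′
      }
      where
      functional : ∀ {d z z'} → d ↦ z ⊎ (d ≡ b × z ≡ w) → d ↦ z' ⊎ (d ≡ b × z' ≡ w) → z ≡ z'
      functional (inj₁ r)            (inj₁ r')             = ↦-functional r r'
      functional (inj₁ r)            (inj₂ (refl , _))     = ⊥-elim (b∉dom (_ , r))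
      functional (inj₂ (refl , _))   (inj₁ r')             = ⊥-elim (b∉dom (_ , r'))
      functional (inj₂ (_ , refl))   (inj₂ (_ , refl))     = refl
      injective′ : ∀ {d d' z} → d ↦ z ⊎ (d ≡ b × z ≡ w) → d' ↦ z ⊎ (d' ≡ b × z ≡ w) → d ≡ d'
      injective′ (inj₁ r)            (inj₁ r')             = ↦-injective r r'
      injective′ (inj₁ r)            (inj₂ (_ , refl))     = ⊥-elim (w∉img (_ , r))
      injective′ (inj₂ (_ , refl))   (inj₁ r')             = ⊥-elim (w∉img (_ , r'))
      injective′ (inj₂ (refl , _))   (inj₂ (refl , _))     = refl
      incidence′ : ∀ {d d' z z'} → d ↦ z ⊎ (d ≡ b × z ≡ w) → d' ↦ z' ⊎ (d' ≡ b × z' ≡ w) →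
        I P z z' ≡ I B d d'
      incidence′ (inj₁ r)             (inj₁ r')            = ↦-I r r'
      incidence′ {d} {z = z} (inj₁ r) (inj₂ (refl , refl)) =
        trans (I-sym P z w) (trans (incidence r) (I-sym B b d))
      incidence′ (inj₂ (refl , refl)) (inj₁ r')            = incidence r'
      incidence′ (inj₂ (refl , refl)) (inj₂ (refl , refl)) = trans (I-irrefl P w) (sym (I-irrefl B b))

    dom-extend : dom extend ≐ (dom h ∪｛ b ｝)
    dom-extend =
      (λ { (z , inj₁ r) → inj₁ (z , r) ; (_ , inj₂ (d≡b , _)) → inj₂ d≡b }) ,
      (λ { (inj₁ (z , r)) → z , inj₁ r ; (inj₂ d≡b) → w , inj₂ (d≡b , refl) })

    img-extend : img extend ≐ (img h ∪｛ w ｝)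
    img-extend =
      (λ { (d , inj₁ r) → inj₁ (d , r) ; (_ , inj₂ (_ , z≡w)) → inj₂ z≡w }) ,
      (λ { (inj₁ (d , r)) → d , inj₁ r ; (inj₂ z≡w) → b , inj₂ (refl , z≡w) })

module Amalgamation {A B C : PartialPlane} (eA : Embedding C A) (eB : Embedding C B) where

  -- h embeds the part of B amalgamated so far.
  record Amalgam : Set₁ where
    field
      P      : PartialPlane
      P-open : Open P
      f      : Embedding A P
      f-HF   : HFEmbedding f
      h      : PartialEmbedding B P
      h-C    : ∀ c → PartialEmbedding._↦_ h (map eB c) (map f (map eA c))
      h-HF   : HFConstructible P (img h)

  Dom : Amalgam → Fin (size B) → Set
  Dom st = dom (Amalgam.h st)

  initial : Open A → HFEmbedding eA → Amalgam
  initial A-open eA-HF = record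
    { P = A ; P-open = A-open ; f = idₑ ; f-HF = idₑ-HF
    ; h = eA ∘ₚ inverse eB ; h-C = λ c → c , refl , refl
    ; h-HF = HFConstructible-≐ A
        ((λ (c , e) → map eB c , c , refl , e) , (λ (_ , c , _ , e) → c , e)) eA-HF
    }

  module Step (st : Amalgam) {b : Fin (size B)} (b∉dom : ¬ Dom st b)
              (b-bound : AtMostTwo (λ x → T (I B b x) × Dom st x)) where
    open Amalgam st
    open PartialEmbedding h hiding (dom; img)

    Result : Set₁
    Result = Σ Amalgam λ st' → Dom st' ≐ (Dom st ∪｛ b ｝)

    N : Fin (size P) → Bool
    N z = isYes (any? λ d → T? (I B b d) ×-dec (d ↦? z))

    N-sound : ∀ {z} → T (N z) → ∃[ d ] (T (I B b d) × d ↦ z)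
    N-sound = toWitness

    N-incidence : ∀ {d z} → d ↦ z → N z ≡ I B b d
    N-incidence {d} d↦z = T-⇔⇒≡ (mk⇔ to (λ bd → fromWitness (d , bd , d↦z)))
      where
      to : T (N _) → T (I B b d)
      to Nz with N-sound Nz
      ... | d' , bd' , d'↦z = subst (T ∘ I B b) (↦-injective d'↦z d↦z) bd'

    SharedNeighbour : Set
    SharedNeighbour = ∃[ u ] ∃[ v ] ∃[ w ] (u ≢ v × T (N u) × T (N v) × T (I P u w) × T (I P v w))

    sharedNeighbour? : Dec SharedNeighbour
    sharedNeighbour? = any? λ u → any? λ v → any? λ w →
      ¬? (u ≟ v) ×-dec T? (N u) ×-dec T? (N v) ×-dec T? (I P u w) ×-dec T? (I P v w)

    module Identify {u v w x y} (u≢v : u ≢ v) (bx : T (I B b x)) (x↦u : x ↦ u)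
                    (by : T (I B b y)) (y↦v : y ↦ v) (uw : T (I P u w)) (vw : T (I P v w)) where
      x≢y : x ≢ y
      x≢y refl = u≢v (↦-functional x↦u y↦v)

      wu : T (I P w u) × img h u
      wu = T-I-sym P uw , x , x↦u

      wv : T (I P w v) × img h v
      wv = T-I-sym P vw , y , y↦v

      w∉img : ¬ img h w
      w∉img (d , d↦w) = linear B d b x y d≢b x≢y
        (subst T (↦-I d↦w x↦u) (proj₁ wu)) bx (subst T (↦-I d↦w y↦v) (proj₁ wv)) by
        where
        d≢b : d ≢ b
        d≢b refl = b∉dom (w , d↦w)

      w-bound : AtMostTwo (λ z → T (I P w z) × img h z)
      w-bound with h-HF
      ... | bs , _ , partition , steps = HFSteps-bound P bs steps (proj₂ (partition w) w∉img)

      type : isPoint P w ≡ isPoint B b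
      type = trans (¬-not (I-type P w u (proj₁ wu)))
                   (trans (cong not (↦-type x↦u)) (sym (¬-not (I-type B b x bx))))

      incidence : ∀ {d z} → d ↦ z → I P w z ≡ I B b d
      incidence {d} {z} d↦z = T-⇔⇒≡ (mk⇔ to from)
        where
        to : T (I P w z) → T (I B b d)
        to wz with AtMostTwo-third w-bound u≢v wu wv (wz , d , d↦z)
        ... | inj₁ refl = subst (T ∘ I B b) (↦-injective x↦u d↦z) bx
        ... | inj₂ refl = subst (T ∘ I B b) (↦-injective y↦v d↦z) by
        from : T (I B b d) → T (I P w z)
        from bd with AtMostTwo-third b-bound x≢y (bx , u , x↦u) (by , v , y↦v) (bd , z , d↦z)
        ... | inj₁ refl = subst (T ∘ I P w) (↦-functional x↦u d↦z) (proj₁ wu)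
        ... | inj₂ refl = subst (T ∘ I P w) (↦-functional y↦v d↦z) (proj₁ wv)

      st' : Amalgam
      st' = record
        { P = P ; P-open = P-open ; f = f ; f-HF = f-HF
        ; h = extend h b∉dom w∉img type incidence
        ; h-C = inj₁ ∘ h-C
        ; h-HF = HFConstructible-≐ P (swap (img-extend h b∉dom w∉img type incidence))
                   (HFConstructible-absorb P h-HF w∉img u≢v wu wv)
        }

      identify : Result
      identify = st' , dom-extend h b∉dom w∉img type incidence

    module Adjoining (¬shared : ¬ SharedNeighbour) where
      N-apart : ∀ {u v z} → u ≢ v → T (N u) → T (N v) → T (I P u z) → T (I P v z) → ⊥
      N-apart u≢v Nu Nv uz vz = ¬shared (_ , _ , _ , u≢v , Nu , Nv , uz , vz)

      N-type : ∀ {z} → T (N z) → isPoint B b ≢ isPoint P z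
      N-type Nz with N-sound Nz
      ... | d , bd , d↦z = λ e → I-type B b d bd (trans e (↦-type d↦z))

      apart : ∀ {d d' z z'} → d ↦ z → d' ↦ z' → z ≢ z' → d ≢ d'
      apart d↦z d↦z' z≢z' refl = z≢z' (↦-functional d↦z d↦z')

      N-bound : AtMostTwo (T ∘ N)
      N-bound (_ , _ , _ , z₁≢z₂ , z₁≢z₃ , z₂≢z₃ , N₁ , N₂ , N₃)
        with N-sound N₁ | N-sound N₂ | N-sound N₃
      ... | d₁ , b₁ , r₁ | d₂ , b₂ , r₂ | d₃ , b₃ , r₃ =
        b-bound (d₁ , d₂ , d₃ , apart r₁ r₂ z₁≢z₂ , apart r₁ r₃ z₁≢z₃ , apart r₂ r₃ z₂≢z₃ ,
                 (b₁ , _ , r₁) , (b₂ , _ , r₂) , (b₃ , _ , r₃))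

      open Adjoin P (isPoint B b) N N-type N-apart N-bound

      b∉dom⁺ : ¬ dom (raise ∘ₚ h) b
      b∉dom⁺ = b∉dom ∘ proj₁ (dom-∘ₚ raise h)

      zero∉img⁺ : ¬ img (raise ∘ₚ h) zero
      zero∉img⁺ (_ , _ , _ , ())

      incidence : ∀ {d y} → PartialEmbedding._↦_ (raise ∘ₚ h) d y → I⁺ zero y ≡ I B b d
      incidence (_ , d↦z , refl) = N-incidence d↦z

      h' : PartialEmbedding B plane
      h' = extend (raise ∘ₚ h) b∉dom⁺ zero∉img⁺ refl incidence

      img-h' : img h' ≐ (img (raise ∘ₚ h) ∪｛ zero ｝)
      img-h' = img-extend (raise ∘ₚ h) b∉dom⁺ zero∉img⁺ refl incidence

      img-h'-suc : ∀ {x} → img h' (suc x) → img h x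
      img-h'-suc i with proj₁ img-h' i
      ... | inj₁ (d , z , d↦z , e) = d , subst (d ↦_) (suc-injective e) d↦z

      h'-HF : HFConstructible plane (img h')
      h'-HF with h-HF
      ... | bs , unique , partition , steps =
        List.map suc bs , Unique.map⁺ suc-injective unique , (λ y → sound y , complete y) ,
        HFSteps-map raise bs pull steps
        where
        sound : ∀ y → y ∈ List.map suc bs → ¬ img h' y
        sound y y∈ i with ∈-map⁻ suc y∈
        ... | p , p∈bs , refl = proj₁ (partition p) p∈bs (img-h'-suc i)
        complete : ∀ y → ¬ img h' y → y ∈ List.map suc bs
        complete zero    ¬i = ⊥-elim (¬i (proj₂ img-h' (inj₂ refl)))
        complete (suc x) ¬i = ∈-map⁺ suc (proj₂ (partition x)
          λ (d , d↦x) → ¬i (proj₂ img-h' (inj₁ (d , x , d↦x , refl))))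
        pull : ∀ {p y} → p ∈ bs → img h' y → T (I⁺ (suc p) y) → ∃[ x ] (suc x ≡ y × img h x)
        pull {p} {zero}  p∈bs _ Np with N-sound Np
        ... | d , _ , d↦p = ⊥-elim (proj₁ (partition p) p∈bs (d , d↦p))
        pull {y = suc x} _ i _ = x , refl , img-h'-suc i

      dom-adjoined : dom h' ≐ (Dom st ∪｛ b ｝)
      dom-adjoined =
        (λ d' → case⁺ (proj₁ (dom-extend (raise ∘ₚ h) b∉dom⁺ zero∉img⁺ refl incidence) d')) ,
        (λ d → proj₂ (dom-extend (raise ∘ₚ h) b∉dom⁺ zero∉img⁺ refl incidence) (case⁻ d))
        where
        case⁺ : ∀ {d} → (dom (raise ∘ₚ h) ∪｛ b ｝) d → (Dom st ∪｛ b ｝) d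
        case⁺ (inj₁ d') = inj₁ (proj₁ (dom-∘ₚ raise h) d')
        case⁺ (inj₂ e)  = inj₂ e
        case⁻ : ∀ {d} → (Dom st ∪｛ b ｝) d → (dom (raise ∘ₚ h) ∪｛ b ｝) d
        case⁻ (inj₁ d') = inj₁ (proj₂ (dom-∘ₚ raise h) d')
        case⁻ (inj₂ e)  = inj₂ e

      st' : Amalgam
      st' = record
        { P = plane ; P-open = plane-open P-open
        ; f = raise ∘ₑ f ; f-HF = HFEmbedding-∘ f raise f-HF raise-HF
        ; h = h' ; h-C = λ c → inj₁ (_ , h-C c , refl) ; h-HF = h'-HF
        }

      adjoin : Result
      adjoin = st' , dom-adjoined

    step : Result
    step with sharedNeighbour?
    ... | yes (u , v , w , u≢v , Nu , Nv , uw , vw) with N-sound Nu | N-sound Nv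
    ...   | x , bx , x↦u | y , by , y↦v = Identify.identify u≢v bx x↦u by y↦v uw vw
    step | no ¬shared = Adjoining.adjoin ¬shared

  build : (st : Amalgam) (rs : List (Fin (size B))) → Unique rs → (∀ {d} → d ∈ rs → ¬ Dom st d) →
    (∀ d → Dom st d ⊎ d ∈ rs) → HFSteps B (Dom st) rs → Σ Amalgam λ st' → ∀ d → Dom st' d
  build st [] _ _ covered _ =
    st , λ d → [ (λ dom → dom) , (λ ()) ] (covered d)
  build st (b ∷ rs) (b∉rs ∷ unique) fresh covered (bound , steps) =
    build st' rs unique fresh' covered' (HFSteps-⊆ B rs (proj₁ grown) steps)
    where
    next : Σ Amalgam λ st' → Dom st' ≐ (Dom st ∪｛ b ｝)
    next = Step.step st (fresh (here refl)) bound
    st' : Amalgam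
    st' = proj₁ next
    grown : Dom st' ≐ (Dom st ∪｛ b ｝)
    grown = proj₂ next
    fresh' : ∀ {d} → d ∈ rs → ¬ Dom st' d
    fresh' d∈rs dom' with proj₁ grown dom'
    ... | inj₁ dom  = fresh (there d∈rs) dom
    ... | inj₂ refl = All.lookup b∉rs d∈rs refl
    covered' : ∀ d → Dom st' d ⊎ d ∈ rs
    covered' d with covered d
    ... | inj₁ dom          = inj₁ (proj₂ grown (inj₁ dom))
    ... | inj₂ (here refl)  = inj₁ (proj₂ grown (inj₂ refl))
    ... | inj₂ (there d∈rs) = inj₂ d∈rs

  amalgamate : Open A → HFEmbedding eA → HFEmbedding eB → Σ Amalgam λ st → ∀ d → Dom st d
  amalgamate A-open eA-HF (bs , unique , partition , steps) =
    build (initial A-open eA-HF) bs unique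
      (λ d∈bs dom → proj₁ (partition _) d∈bs (proj₁ dom₀ dom)) covered
      (HFSteps-⊆ B bs (proj₁ dom₀) steps)
    where
    dom₀ : Dom (initial A-open eA-HF) ≐ (λ d → ∃[ c ] map eB c ≡ d)
    dom₀ = dom-∘ₚ eA (inverse eB)
    covered : ∀ d → Dom (initial A-open eA-HF) d ⊎ d ∈ bs
    covered d with any? (λ c → map eB c ≟ d)
    ... | yes inC = inj₁ (proj₂ dom₀ inC)
    ... | no ¬inC = inj₂ (proj₂ (partition d) ¬inC)

lemma8p9 : (A B C : PartialPlane) → Open A → Open B → Open C →
    (eA : Embedding C A) → HFEmbedding eA →
    (eB : Embedding C B) → HFEmbedding eB →
    ∃[ D ] (Open D × Σ (Embedding A D) λ f → Σ (Embedding B D) λ g →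
      ((∀ c → map f (map eA c) ≡ map g (map eB c)) ×
       HFEmbedding f × HFEmbedding g))
lemma8p9 A B C A-open _ _ eA eA-HF eB eB-HF =
  P , P-open , f , g , agree , f-HF , HFConstructible-≐ P (img-toEmbedding h total) h-HF
  where
  open Amalgamation eA eB
  amalgam : Σ Amalgam λ st → ∀ d → Dom st d
  amalgam = amalgamate A-open eA-HF eB-HF
  open Amalgam (proj₁ amalgam)
  total : ∀ d → dom h d
  total = proj₂ amalgam
  g : Embedding B P
  g = toEmbedding h total
  agree : ∀ c → map f (map eA c) ≡ map g (map eB c)
  agree c = PartialEmbedding.↦-functional h (h-C c) (proj₂ (total (map eB c)))
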